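{- Let $G=(V,E)$ be a multigraph, $\mathcal{P}$ a partition of $V$, $c$ a positive integer, $CC$ a $c$-cut containment set for $G$ and $\mathcal{P}$, and $F$ an unweighted spanning forest of $G\setminus CC$. Then for every integer $\gamma>c$ the multigraph $H=\mathsf{Sparsifier}_{c,\gamma}(G,\mathcal{P},CC,F)$ satisfies: (1) the cut-set of any $c$-cut of $H$ is the cut-set of a cut of $G$ of the same size; (2) if $G$ has a $c$-cut $C$ that partitions $T_{G,\mathcal{P}}$ into two non-empty sets $T'$ and $T_{G,\mathcal{P}}\setminus T'$, then $H$ has a cut $C'$ of size at most the size of $C$ that partitions $T_{G,\mathcal{P}}$ into $T'$ and $T_{G,\mathcal{P}}\setminus T'$.
   Context: A multigraph $G=(V,E)$ has edge set consisting of triples $(u,v,\alpha)$ with $\alpha$ a positive integer multiplicity, at most one triple per unordered pair. For $E'\subseteq E$, $\mathsf{End}(E')$ is the set of endpoints of its edges and $G\setminus E'=(V,E\setminus E')$. A cut is a bipartition of the vertex set into two non-empty sets; its cut-set is the set of crossing edges; its size is the sum of their multiplicities; it is a $c$-cut if its size is at most $c$. For a vertex set $X$, $G[X]$ is the induced subgraph, $\partial_G(X)$ the set of edges with exactly one endpoint in $X$. For a partition $\mathcal{P}$ of $V$ (whose parts are clusters), $\partial_G(\mathcal{P})=\bigcup_{P\in\mathcal{P}}\partial_G(P)$ is the set of intercluster edges and $T_{G,\mathcal{P}}=\mathsf{End}(\partial_G(\mathcal{P}))$ is the set of terminals. For $T\subseteq V$, a $(T',T\setminus T',c)$-cut is a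 $c$-cut partitioning $T$ into $T'$ and $T\setminus T'$. A set $CC\subseteq E$ is a $c$-cut containment set with respect to $T$ if $CC$ is exactly the set of intercluster edges of some partition of $V$, and for every bipartition $(T',T\setminus T')$ of $T$ such that $G$ has a $(T',T\setminus T',c)$-cut, some minimum-size $(T',T\setminus T',c)$-cut has its cut-set contained in $CC$. A $c$-cut containment set for $G$ and $\mathcal{P}$ is the union of $\partial_G(\mathcal{P})$ with, for each $P\in\mathcal{P}$, a $c$-cut containment set of $G[P]$ with respect to the terminals $T_{G,\mathcal{P}}\cap P$. For an unweighted forest $F$ and $K\subseteq V(F)$, $\mathsf{Contract}_K(F)$ is obtained from $F$ by repeatedly deleting vertices not in $K$ of degree at most $1$ and shortcutting vertices not in $K$ of degree $2$. For a multigraph $G$, terminals $T$, a $c$-cut containment set $CC$ w.r.t. $T$, a spanning forest $F$ of $G\setminus CC$ and $\gamma>c$, $\mathsf{Sparsifier}_{c,\gamma}(G,T,CC,F)$ is the multigraph with vertex set that of $\mathsf{Contract}_{T\cup\mathsf{End}(CC)}(F)$, edges those of $CC$ and of this contracted forest, with multiplicity $\alpha$ for an edge $(x,y,\alpha)\in CC$ and $\gamma$ otherwise. Finally, $\mathsf{Sparsifier}_{c,\gamma}(G,\mathcal{P},CC,F)$ is obtained from $G$ by replacing, for each $P\in\mathcal{P}$, the induced subgraph $G[P]$ by $\mathsf{Sparsifier}_{c,\gamma}(G[P],T_{G,\mathcal{P}}\cap P,CC\cap E(G[P]),F[P])$ (intercluster edges are kept). -}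

module Defs where

open import Data.Bool using (Bool; true; false; not; _∧_; _∨_; _xor_; if_then_else_)
open import Data.Nat using (ℕ; _≤_)
open import Data.Fin using (Fin; _≟_)
open import Data.List using (List; []; _∷_; _++_; filterᵇ; map; length; concatMap; allFin)
open import Data.Nat.ListAction using (sum)
open import Data.Bool.ListAction using (any)
open import Data.List.Membership.Propositional using (_∈_)
open import Data.List.Relation.Unary.AllPairs using (AllPairs)
open import Data.List.Relation.Unary.Unique.Propositional using (Unique)
open import Data.Product using (Σ; ∃; _×_; _,_; proj₁; proj₂)
open import Data.Sum using (_⊎_)
open import Data.Unit using (⊤)
open import Relation.Nullary using (¬_; does)
open import Relation.Binary.PropositionalEquality using (_≡_; _≢_)
open import Relation.Binary.Construct.Closure.ReflexiveTransitive using (Star)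

-- Vertices are elements of Fin n (an ambient vertex universe); vertex
-- sets are Boolean predicates on Fin n.

_==_ : ∀ {n} → Fin n → Fin n → Bool
a == b = does (a ≟ b)

-- An edge is a triple (u , v , α), α its multiplicity.
Edge : ℕ → Set
Edge n = Fin n × Fin n × ℕ

src : ∀ {n} → Edge n → Fin n
src e = proj₁ e

tgt : ∀ {n} → Edge n → Fin n
tgt e = proj₁ (proj₂ e)

mult : ∀ {n} → Edge n → ℕ
mult e = proj₂ (proj₂ e)

ends : ∀ {n} → Edge n → Fin n × Fin n
ends e = src e , tgt e

SamePair : ∀ {n} → Fin n × Fin n → Fin n × Fin n → Set
SamePair (a , b) (c , d) = (a ≡ c × b ≡ d) ⊎ (a ≡ d × b ≡ c)

record Graph (n : ℕ) : Set where
  constructor graph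
  field
    V : Fin n → Bool
    E : List (Edge n)
open Graph public

IsMultigraph : ∀ {n} → Graph n → Set
IsMultigraph G =
  (∀ e → e ∈ E G → V G (src e) ≡ true × V G (tgt e) ≡ true × src e ≢ tgt e × 1 ≤ mult e)
  × AllPairs (λ e f → ¬ SamePair (ends e) (ends f)) (E G)

-- A subset of the edge set of G is given by a Boolean predicate X:
-- it denotes { e ∈ E G | X e ≡ true }.
EdgeSet : ℕ → Set
EdgeSet n = Edge n → Bool

_∖ₑ_ : ∀ {n} → Graph n → EdgeSet n → Graph n
G ∖ₑ X = graph (V G) (filterᵇ (λ e → not (X e)) (E G))

End : ∀ {n} → Graph n → EdgeSet n → Fin n → Set
End G X v = Σ (Edge _) λ e → e ∈ E G × X e ≡ true × (v ≡ src e ⊎ v ≡ tgt e)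

-- Cuts.  A cut is given by S : Fin n → Bool; its two sides are
-- V ∩ S and V ∖ S, both required to be non-empty.

IsCut : ∀ {n} → Graph n → (Fin n → Bool) → Set
IsCut G S = (∃ λ v → V G v ≡ true × S v ≡ true) × (∃ λ v → V G v ≡ true × S v ≡ false)

crosses : ∀ {n} → (Fin n → Bool) → Edge n → Bool
crosses S e = S (src e) xor S (tgt e)

cutSet : ∀ {n} → Graph n → (Fin n → Bool) → List (Edge n)
cutSet G S = filterᵇ (crosses S) (E G)

weight : ∀ {n} → List (Edge n) → ℕ
weight es = sum (map mult es)

cutSize : ∀ {n} → Graph n → (Fin n → Bool) → ℕ
cutSize G S = weight (cutSet G S)

IsCCut : ∀ {n} → ℕ → Graph n → (Fin n → Bool) → Set
IsCCut c G S = IsCut G S × cutSize G S ≤ c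

-- The cut S partitions the terminal set T into T ∩ Tp and T ∖ Tp
-- (cuts are unordered, so either side may be the T ∩ Tp side).
Separates : ∀ {n} → (Fin n → Set) → (Fin n → Bool) → (Fin n → Bool) → Set
Separates T Tp S = (∀ t → T t → S t ≡ Tp t) ⊎ (∀ t → T t → S t ≡ not (Tp t))

IsTCut : ∀ {n} → ℕ → Graph n → (Fin n → Set) → (Fin n → Bool) → (Fin n → Bool) → Set
IsTCut c G T Tp S = IsCCut c G S × Separates T Tp S

-- Partitions of the vertex set, given as labellings (parts = non-empty
-- fibres of the labelling inside V).

Partition : ℕ → Set
Partition n = Fin n → Fin n

Part : ∀ {n} → Graph n → Partition n → Fin n → Fin n → Bool
Part G ℓ p v = V G v ∧ (ℓ v == p)

isInter : ∀ {n} → Partition n → EdgeSet n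
isInter ℓ e = not (ℓ (src e) == ℓ (tgt e))

Induced : ∀ {n} → Graph n → (Fin n → Bool) → Graph n
Induced G X = graph (λ v → V G v ∧ X v) (filterᵇ (λ e → X (src e) ∧ X (tgt e)) (E G))

Terminal : ∀ {n} → Graph n → Partition n → Fin n → Set
Terminal G ℓ = End G (isInter ℓ)

TerminalIn : ∀ {n} → Graph n → Partition n → Fin n → Fin n → Set
TerminalIn G ℓ p v = Terminal G ℓ v × Part G ℓ p v ≡ true

IsContainmentSet : ∀ {n} → ℕ → Graph n → (Fin n → Set) → EdgeSet n → Set
IsContainmentSet {n} c G T X =
  (Σ (Partition n) λ m → ∀ e → e ∈ E G → X e ≡ isInter m e)
  × (∀ (Tp : Fin n → Bool) → (∃ λ S → IsTCut c G T Tp S) →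
       ∃ λ S → IsTCut c G T Tp S
             × (∀ S' → IsTCut c G T Tp S' → cutSize G S ≤ cutSize G S')
             × (∀ e → e ∈ cutSet G S → X e ≡ true))

-- X is a c-cut containment set for G and the partition ℓ:
-- X = ∂_G(𝒫) ∪ ⋃_P X_P with X_P a c-cut containment set of G[P] w.r.t. T ∩ P
ContainmentSetFor : ∀ {n} → ℕ → Graph n → Partition n → EdgeSet n → Set
ContainmentSetFor {n} c G ℓ X =
  Σ (Fin n → EdgeSet n) λ Xs →
    (∀ p → IsContainmentSet c (Induced G (Part G ℓ p)) (TerminalIn G ℓ p) (Xs p))
    × (∀ e → e ∈ E G →
         (X e ≡ true → isInter ℓ e ≡ true ⊎ (∃ λ p → e ∈ E (Induced G (Part G ℓ p)) × Xs p e ≡ true))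
         × (isInter ℓ e ≡ true ⊎ (∃ λ p → e ∈ E (Induced G (Part G ℓ p)) × Xs p e ≡ true) → X e ≡ true))

record Forest (n : ℕ) : Set where
  constructor forest
  field
    FV : Fin n → Bool
    FE : List (Fin n × Fin n)
open Forest public

Adj : ∀ {n} → List (Fin n × Fin n) → Fin n → Fin n → Set
Adj es a b = (a , b) ∈ es ⊎ (b , a) ∈ es

Connected : ∀ {n} → List (Fin n × Fin n) → Fin n → Fin n → Set
Connected es = Star (Adj es)

Walk : ∀ {n} → List (Fin n × Fin n) → List (Fin n) → Set
Walk es [] = ⊤
Walk es (x ∷ []) = ⊤
Walk es (x ∷ y ∷ r) = Adj es x y × Walk es (y ∷ r)

HasCycle : ∀ {n} → List (Fin n × Fin n) → Set
HasCycle {n} es =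
  Σ (Fin n) λ x → Σ (List (Fin n)) λ vs →
    2 ≤ length vs × Unique (x ∷ vs) × Walk es (x ∷ vs ++ x ∷ [])

IsSpanningForest : ∀ {n} → Graph n → Forest n → Set
IsSpanningForest G F =
  (∀ v → FV F v ≡ V G v)
  × (∀ a b → (a , b) ∈ FE F → a ≢ b × (∃ λ α → (a , b , α) ∈ E G ⊎ (b , a , α) ∈ E G))
  × AllPairs (λ x y → ¬ SamePair x y) (FE F)
  × ¬ HasCycle (FE F)
  × (∀ e → e ∈ E G → Connected (FE F) (src e) (tgt e))

InducedForest : ∀ {n} → Forest n → (Fin n → Bool) → Forest n
InducedForest F X =
  forest (λ v → FV F v ∧ X v) (filterᵇ (λ ab → X (proj₁ ab) ∧ X (proj₂ ab)) (FE F))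

-- Contract_K(F), as the relation "F reduces to F' by the rules and no
-- rule applies to F'".

incident : ∀ {n} → Fin n → Fin n × Fin n → Bool
incident v ab = (proj₁ ab == v) ∨ (proj₂ ab == v)

degree : ∀ {n} → List (Fin n × Fin n) → Fin n → ℕ
degree es v = length (filterᵇ (incident v) es)

other : ∀ {n} → Fin n → Fin n × Fin n → Fin n
other v ab = if proj₁ ab == v then proj₂ ab else proj₁ ab

removeV : ∀ {n} → (Fin n → Bool) → Fin n → Fin n → Bool
removeV FVs v w = if w == v then false else FVs w

dropIncident : ∀ {n} → Fin n → List (Fin n × Fin n) → List (Fin n × Fin n)
dropIncident v es = filterᵇ (λ ab → not (incident v ab)) es

data ContractStep {n} (K : Fin n → Set) : Forest n → Forest n → Set where
  delete : ∀ {FVs es} v → FVs v ≡ true → ¬ K v → degree es v ≤ 1 →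
    ContractStep K (forest FVs es) (forest (removeV FVs v) (dropIncident v es))
  shortcut : ∀ {FVs es} v x y → FVs v ≡ true → ¬ K v → filterᵇ (incident v) es ≡ x ∷ y ∷ [] →
    ContractStep K (forest FVs es)
      (forest (removeV FVs v) ((other v x , other v y) ∷ dropIncident v es))

IsContraction : ∀ {n} → (Fin n → Set) → Forest n → Forest n → Set
IsContraction K F F' = Star (ContractStep K) F F' × (∀ F'' → ¬ ContractStep K F' F'')

KeepSet : ∀ {n} → Graph n → Partition n → EdgeSet n → Fin n → Fin n → Set
KeepSet G ℓ X p v = TerminalIn G ℓ p v ⊎ End (Induced G (Part G ℓ p)) X v

-- Sparsifier_{c,γ}(G,𝒫,CC,F), where cf p is Contract_{K_p}(F[P_p]).
Sparsifier : ∀ {n} → ℕ → Graph n → Partition n → EdgeSet n → (Fin n → Forest n) → Graph n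
Sparsifier {n} γ G ℓ X cf =
  graph (λ v → any (λ p → FV (cf p) v) (allFin n))
        (filterᵇ (isInter ℓ) (E G)
         ++ concatMap (λ p → filterᵇ X (E (Induced G (Part G ℓ p)))
                             ++ map (λ ab → (proj₁ ab , proj₂ ab , γ)) (FE (cf p)))
                      (allFin n))

-- A c-cut S of H cannot cut an edge of weight γ > c, so S is constant on every contracted forest.
-- Undoing the deletions and shortcuts (a removed vertex takes the label of its neighbours) extends
-- it, cluster by cluster, to a labelling S' of G that is constant along the spanning forest F and
-- agrees with S on every vertex kept in H. Hence S' cuts no edge outside CC, and it cuts a CC-edge,
-- whose endpoints are kept, exactly when S does; as H keeps CC with its multiplicities, the two
-- cut-sets and sizes coincide.
--
-- Conversely, for a c-cut S of G, replace S inside each cluster by a minimum cut with the same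
-- terminal sides whose cut-set lies in the cluster's containment set. The glued labelling agrees
-- with S on the terminals, hence on intercluster edges, and cuts no edge of F (these avoid CC), so
-- it is constant on the contracted forests: in H it cuts only CC-edges, and in each cluster no
-- more weight than S does.

module Submission where

open import Defs
open import Data.Bool using (Bool; true; false; not; _∧_; _xor_; if_then_else_; T?)
open import Data.Bool.Properties
  using (T-≡; xor-same; xor-comm; xor-annihilates-not; not-involutive; ∧-conicalˡ; ∧-conicalʳ; ∧-idem)
open import Data.Nat using (ℕ; zero; suc; _+_; _≤_; _<_; s≤s)
open import Data.Nat.Properties
  using ( ≤-refl; ≤-trans; ≤-reflexive; +-mono-≤; +-monoʳ-≤; m≤n+m; m≤m+n; +-identityʳ; <⇒≱
        ; +-commutativeSemigroup; module ≤-Reasoning)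
open import Algebra.Properties.CommutativeSemigroup +-commutativeSemigroup using (interchange)
open import Data.Nat.ListAction using (sum)
open import Data.Nat.ListAction.Properties using (sum-++)
open import Data.Fin using (Fin; zero; suc; _≟_)
open import Data.List using (List; []; _∷_; _++_; filterᵇ; map; concatMap; allFin; tabulate)
open import Data.List.Properties using (filter-++; map-++; map-cong; map-tabulate)
open import Data.List.Relation.Unary.All as All using (All; []; _∷_)
open import Data.List.Relation.Unary.Any using (here; there)
open import Data.List.Relation.Unary.Any.Properties using (¬Any[]; any⁺; any⁻)
open import Data.List.Membership.Propositional using (_∈_; find; lose)
open import Data.List.Membership.Propositional.Properties
  using ( ∈-filter⁺; ∈-filter⁻; ∈-++⁺ˡ; ∈-++⁺ʳ; ∈-++⁻; ∈-map⁺; ∈-map⁻; ∈-allFin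
        ; ∈-concatMap⁺; ∈-concatMap⁻)
open import Data.Product using (Σ; ∃; _×_; _,_; proj₁; proj₂)
open import Data.Sum using (_⊎_; inj₁; inj₂)
open import Data.Empty using (⊥-elim)
open import Function using (_∘_; Equivalence)
open import Relation.Nullary using (Dec; yes; no)
open import Relation.Nullary.Decidable using (dec-true; dec-false)
open import Relation.Binary.PropositionalEquality
open import Relation.Binary.Construct.Closure.ReflexiveTransitive using (Star; ε; _◅_)

==⇒≡ : ∀ {n} {a b : Fin n} → (a == b) ≡ true → a ≡ b
==⇒≡ {a = a} {b} eq with a ≟ b | eq
... | yes a≡b | _ = a≡b

≡⇒== : ∀ {n} {a b : Fin n} → a ≡ b → (a == b) ≡ true
≡⇒== {a = a} {b} = dec-true (a ≟ b)

≢⇒== : ∀ {n} {a b : Fin n} → a ≢ b → (a == b) ≡ false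
≢⇒== {a = a} {b} = dec-false (a ≟ b)

true≢false : true ≢ false
true≢false ()

module _ {A : Set} where

  ∈-filterᵇ⁺ : ∀ (p : A → Bool) {x xs} → x ∈ xs → p x ≡ true → x ∈ filterᵇ p xs
  ∈-filterᵇ⁺ p x∈xs px = ∈-filter⁺ (T? ∘ p) x∈xs (Equivalence.from T-≡ px)

  ∈-filterᵇ⁻ : ∀ (p : A → Bool) {x xs} → x ∈ filterᵇ p xs → x ∈ xs × p x ≡ true
  ∈-filterᵇ⁻ p x∈ with x∈xs , px ← ∈-filter⁻ (T? ∘ p) x∈ = x∈xs , Equivalence.to T-≡ px

  filterᵇ-cong : ∀ {p q : A → Bool} xs → (∀ {x} → x ∈ xs → p x ≡ q x) →
    filterᵇ p xs ≡ filterᵇ q xs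
  filterᵇ-cong [] _ = refl
  filterᵇ-cong {p} {q} (x ∷ xs) p≗q with p x | q x | p≗q (here refl)
  ... | true  | true  | _ = cong (x ∷_) (filterᵇ-cong xs (p≗q ∘ there))
  ... | false | false | _ = filterᵇ-cong xs (p≗q ∘ there)

  filterᵇ-filterᵇ : ∀ (p q : A → Bool) xs →
    filterᵇ q (filterᵇ p xs) ≡ filterᵇ (λ x → p x ∧ q x) xs
  filterᵇ-filterᵇ p q [] = refl
  filterᵇ-filterᵇ p q (x ∷ xs) with p x
  ... | false = filterᵇ-filterᵇ p q xs
  ... | true with q x
  ...   | true  = cong (x ∷_) (filterᵇ-filterᵇ p q xs)
  ...   | false = filterᵇ-filterᵇ p q xs

xor-false⇒≡ : ∀ {x y} → (x xor y) ≡ false → x ≡ y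
xor-false⇒≡ {true}  {true}  _ = refl
xor-false⇒≡ {false} {false} _ = refl

≡⇒xor-false : ∀ {x y} → x ≡ y → (x xor y) ≡ false
≡⇒xor-false {x} refl = xor-same x

infix 7 _when_
_when_ : ℕ → Bool → ℕ
r when b = if b then r else 0

module _ {A : Set} where

  sum-map-+ : ∀ (f g : A → ℕ) xs →
    sum (map (λ x → f x + g x) xs) ≡ sum (map f xs) + sum (map g xs)
  sum-map-+ f g [] = refl
  sum-map-+ f g (x ∷ xs) = trans (cong (f x + g x +_) (sum-map-+ f g xs)) (interchange (f x) (g x) _ _)

  sum-map-zero : ∀ (f : A → ℕ) xs → (∀ x → f x ≡ 0) → sum (map f xs) ≡ 0
  sum-map-zero f [] f≗0 = refl
  sum-map-zero f (x ∷ xs) f≗0 = cong₂ _+_ (f≗0 x) (sum-map-zero f xs f≗0)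

  sum-map-mono : ∀ (f g : A → ℕ) xs → (∀ x → f x ≤ g x) → sum (map f xs) ≤ sum (map g xs)
  sum-map-mono f g [] f≤g = ≤-refl
  sum-map-mono f g (x ∷ xs) f≤g = +-mono-≤ (f≤g x) (sum-map-mono f g xs f≤g)

sum-tabulate-δ : ∀ {m} (a : Fin m) r → sum (tabulate (λ p → r when (a == p))) ≡ r
sum-tabulate-δ {suc m} zero r = trans (cong (r +_) (zeros m)) (+-identityʳ r)
  where
  zeros : ∀ k → sum (tabulate {n = k} (λ _ → 0)) ≡ 0
  zeros zero = refl
  zeros (suc k) = zeros k
sum-tabulate-δ (suc a) r = sum-tabulate-δ a r

sum-allFin-δ : ∀ {m} (a : Fin m) r → sum (map (λ p → r when (a == p)) (allFin m)) ≡ r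
sum-allFin-δ a r =
  trans (cong sum (map-tabulate (λ p → p) (λ p → r when (a == p)))) (sum-tabulate-δ a r)

weightOf : ∀ {n} → EdgeSet n → List (Edge n) → ℕ
weightOf Q es = weight (filterᵇ Q es)

module _ {n : ℕ} where

  weight-++ : ∀ (es fs : List (Edge n)) → weight (es ++ fs) ≡ weight es + weight fs
  weight-++ es fs = trans (cong sum (map-++ mult es fs)) (sum-++ (map mult es) (map mult fs))

  weightOf-∷ : ∀ (Q : EdgeSet n) e es → weightOf Q (e ∷ es) ≡ mult e when Q e + weightOf Q es
  weightOf-∷ Q e es with Q e
  ... | true  = refl
  ... | false = refl

  weightOf-filterᵇ-∷ : ∀ (Q P : EdgeSet n) e es →
    weightOf Q (filterᵇ P (e ∷ es)) ≡ (mult e when Q e) when P e + weightOf Q (filterᵇ P es)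
  weightOf-filterᵇ-∷ Q P e es with P e
  ... | true  = weightOf-∷ Q e (filterᵇ P es)
  ... | false = refl

  weightOf-++ : ∀ (Q : EdgeSet n) es fs →
    weightOf Q (es ++ fs) ≡ weightOf Q es + weightOf Q fs
  weightOf-++ Q es fs =
    trans (cong weight (filter-++ (T? ∘ Q) es fs)) (weight-++ (filterᵇ Q es) (filterᵇ Q fs))

  weightOf-concatMap : ∀ {I : Set} (Q : EdgeSet n) (f : I → List (Edge n)) ps →
    weightOf Q (concatMap f ps) ≡ sum (map (λ p → weightOf Q (f p)) ps)
  weightOf-concatMap Q f [] = refl
  weightOf-concatMap Q f (p ∷ ps) =
    trans (weightOf-++ Q (f p) (concatMap f ps)) (cong (_ +_) (weightOf-concatMap Q f ps))

  weightOf-mono : ∀ {P Q : EdgeSet n} es → (∀ {e} → e ∈ es → P e ≡ true → Q e ≡ true) →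
    weightOf P es ≤ weightOf Q es
  weightOf-mono [] _ = ≤-refl
  weightOf-mono {P} {Q} (e ∷ es) P⇒Q with P e in Pe | Q e in Qe
  ... | true  | true  = +-monoʳ-≤ (mult e) (weightOf-mono es (P⇒Q ∘ there))
  ... | true  | false = ⊥-elim (true≢false (trans (sym (P⇒Q (here refl) Pe)) Qe))
  ... | false | true  = ≤-trans (weightOf-mono es (P⇒Q ∘ there)) (m≤n+m _ (mult e))
  ... | false | false = weightOf-mono es (P⇒Q ∘ there)

  weightOf-none : ∀ (Q : EdgeSet n) es → (∀ {e} → e ∈ es → Q e ≡ false) → weightOf Q es ≡ 0
  weightOf-none Q [] _ = refl
  weightOf-none Q (e ∷ es) ¬Q with Q e | ¬Q (here refl)
  ... | false | _ = weightOf-none Q es (¬Q ∘ there)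

  mult≤weightOf : ∀ (Q : EdgeSet n) {e es} → e ∈ es → Q e ≡ true → mult e ≤ weightOf Q es
  mult≤weightOf Q {es = e ∷ es} (here refl) Qe rewrite Qe = m≤m+n (mult e) _
  mult≤weightOf Q {es = f ∷ es} (there e∈es) Qe with Q f
  ... | true  = ≤-trans (mult≤weightOf Q e∈es Qe) (m≤n+m _ (mult f))
  ... | false = mult≤weightOf Q e∈es Qe

module _ {n : ℕ} where

  EndpointsIn : (Fin n → Bool) → Edge n → Set
  EndpointsIn X e = X (src e) ≡ true × X (tgt e) ≡ true

  crosses-cong : ∀ {S T : Fin n → Bool} e → S (src e) ≡ T (src e) → S (tgt e) ≡ T (tgt e) →
    crosses S e ≡ crosses T e
  crosses-cong e = cong₂ _xor_

  crosses-samePair : ∀ (S : Fin n → Bool) e {a b} → SamePair (ends e) (a , b) →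
    crosses S e ≡ (S a xor S b)
  crosses-samePair S e (inj₁ (refl , refl)) = refl
  crosses-samePair S e (inj₂ (refl , refl)) = xor-comm (S (src e)) (S (tgt e))

  samePair⇒ : ∀ {X : Fin n → Bool} {e a b} → SamePair (ends e) (a , b) → EndpointsIn X e →
    X a ≡ true × X b ≡ true
  samePair⇒ (inj₁ (refl , refl)) (xs , xt) = xs , xt
  samePair⇒ (inj₂ (refl , refl)) (xs , xt) = xt , xs

  samePair⇐ : ∀ {X : Fin n → Bool} {e a b} → SamePair (ends e) (a , b) → X a ≡ true → X b ≡ true →
    EndpointsIn X e
  samePair⇐ (inj₁ (refl , refl)) xa xb = xa , xb
  samePair⇐ (inj₂ (refl , refl)) xa xb = xb , xa

  cutSet-complement : ∀ (G : Graph n) S → cutSet G (not ∘ S) ≡ cutSet G S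
  cutSet-complement G S = filterᵇ-cong (E G) (λ {e} _ → xor-annihilates-not (S (src e)) (S (tgt e)))

  crossing⇒IsCut : ∀ (G : Graph n) S {e} → e ∈ cutSet G S → EndpointsIn (V G) e → IsCut G S
  crossing⇒IsCut G S {e} e∈cut (vs , vt)
    with S (src e) in Ss | S (tgt e) in St | proj₂ (∈-filterᵇ⁻ (crosses S) {xs = E G} e∈cut)
  ... | true  | false | _ = (src e , vs , Ss) , (tgt e , vt , St)
  ... | false | true  | _ = (tgt e , vt , St) , (src e , vs , Ss)
  ... | true  | true  | ()
  ... | false | false | ()

record ContainedReplacement {n} (G : Graph n) (T : Fin n → Set) (X : EdgeSet n) (S : Fin n → Bool) : Set
  where
  field
    cut       : Fin n → Bool
    agrees    : ∀ t → T t → cut t ≡ S t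
    no-larger : cutSize G cut ≤ cutSize G S
    contained : ∀ {e} → e ∈ cutSet G cut → X e ≡ true

module _ {n} {G : Graph n} {T : Fin n → Set} {X : EdgeSet n} where

  uncut-replacement : ∀ {S} → cutSet G S ≡ [] → ContainedReplacement G T X S
  uncut-replacement {S} noCrossing = record
    { cut = S ; agrees = λ _ _ → refl ; no-larger = ≤-refl
    ; contained = λ e∈ → ⊥-elim (¬Any[] (subst (_ ∈_) noCrossing e∈)) }

  contained-replacement : ∀ {c S} → IsContainmentSet c G T X → IsCCut c G S → ContainedReplacement G T X S
  contained-replacement {c} {S} (_ , minimal) S-cut with minimal S (S , S-cut , inj₁ (λ _ _ → refl))
  ... | M , (_ , inj₁ M≗S) , M-min , M⊆X = record
    { cut = M ; agrees = M≗S ; no-larger = M-min S (S-cut , inj₁ (λ _ _ → refl)) ; contained = M⊆X _ }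
  ... | M , (_ , inj₂ M≗¬S) , M-min , M⊆X = record
    { cut = not ∘ M
    ; agrees = λ t Tt → trans (cong not (M≗¬S t Tt)) (not-involutive (S t))
    ; no-larger = ≤-trans (≤-reflexive (cong weight (cutSet-complement G M)))
                          (M-min S (S-cut , inj₁ (λ _ _ → refl)))
    ; contained = λ e∈ → M⊆X _ (subst (_ ∈_) (cutSet-complement G M) e∈) }

Uncut : ∀ {n} → List (Fin n × Fin n) → (Fin n → Bool) → Set
Uncut es S = ∀ {a b} → (a , b) ∈ es → S a ≡ S b

uncut-connected : ∀ {n} {es : List (Fin n × Fin n)} {S x y} → Uncut es S → Connected es x y →
  S x ≡ S y
uncut-connected uncut ε = refl
uncut-connected uncut (inj₁ xz∈ ◅ path) = trans (uncut xz∈) (uncut-connected uncut path)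
uncut-connected uncut (inj₂ zx∈ ◅ path) = trans (sym (uncut zx∈)) (uncut-connected uncut path)

infixl 9 _[_≔_]
_[_≔_] : ∀ {n} → (Fin n → Bool) → Fin n → Bool → Fin n → Bool
(S [ v ≔ val ]) w = if w == v then val else S w

module _ {n : ℕ} where

  removeV-true : ∀ (FVs : Fin n → Bool) v w → removeV FVs v w ≡ true →
    FVs w ≡ true × (w == v) ≡ false
  removeV-true FVs v w w∈ with w == v
  ... | false = w∈ , refl

  removeV-keeps : ∀ (FVs : Fin n → Bool) {v w} → w ≢ v → FVs w ≡ true → removeV FVs v w ≡ true
  removeV-keeps FVs {v} {w} w≢v w∈ = trans (cong (λ b → if b then false else FVs w) (≢⇒== w≢v)) w∈

  override-away : ∀ (S : Fin n → Bool) {v val w} → (w == v) ≡ false → (S [ v ≔ val ]) w ≡ S w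
  override-away S {v} {val} {w} w≠v = cong (λ b → if b then val else S w) w≠v

  override-removed : ∀ (S : Fin n → Bool) FVs {v val w} → removeV FVs v w ≡ true →
    (S [ v ≔ val ]) w ≡ S w
  override-removed S FVs {v} {w = w} w∈ = override-away S (proj₂ (removeV-true FVs v w w∈))

  not-incident : ∀ {v a b : Fin n} → incident v (a , b) ≡ false →
    (a == v) ≡ false × (b == v) ≡ false
  not-incident {v} {a} {b} _ with a == v | b == v
  ... | false | false = refl , refl

  incident-other : ∀ (S : Fin n → Bool) {v a b} → incident v (a , b) ≡ true → S a ≡ S b →
    S (other v (a , b)) ≡ S v
  incident-other S {v} {a} {b} inc Sa≡Sb with a == v in a=v
  ... | true  = trans (sym Sa≡Sb) (cong S (==⇒≡ a=v))
  ... | false = trans Sa≡Sb (cong S (==⇒≡ inc))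

  override-incident : ∀ (S : Fin n → Bool) {v val a b} → incident v (a , b) ≡ true →
    S (other v (a , b)) ≡ val → (S [ v ≔ val ]) a ≡ (S [ v ≔ val ]) b
  override-incident S {v} {a = a} {b} inc nbr with a == v | b == v
  ... | true  | true  = refl
  ... | true  | false = sym nbr
  ... | false | true  = nbr
  ... | false | false = ⊥-elim (true≢false (sym inc))

  override-uncut : ∀ {v val es xs} {S : Fin n → Bool} → filterᵇ (incident v) es ≡ xs →
    (∀ {x} → x ∈ xs → S (other v x) ≡ val) →
    Uncut (dropIncident v es) S → Uncut es (S [ v ≔ val ])
  override-uncut {v} {val} {es} {S = S} nbrs nbr-labels uncut {a} {b} ab∈ with incident v (a , b) in inc
  ... | true  =
    override-incident S inc (nbr-labels (subst (_ ∈_) nbrs (∈-filterᵇ⁺ (incident v) ab∈ inc)))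
  ... | false with a≠v , b≠v ← not-incident {v} {a} {b} inc = begin
    (S [ v ≔ val ]) a  ≡⟨ override-away S a≠v ⟩
    S a                ≡⟨ uncut (∈-filterᵇ⁺ (not ∘ incident v) ab∈ (cong not inc)) ⟩
    S b                ≡⟨ override-away S b≠v ⟨
    (S [ v ≔ val ]) b  ∎
    where open ≡-Reasoning

module Contraction {n} (K : Fin n → Set) where

  Steps : Forest n → Forest n → Set
  Steps = Star (ContractStep K)

  step-vertices⊆ : ∀ {F F'} → ContractStep K F F' → ∀ {w} → FV F' w ≡ true → FV F w ≡ true
  step-vertices⊆ (delete {FVs} v _ _ _) {w} w∈ = proj₁ (removeV-true FVs v w w∈)
  step-vertices⊆ (shortcut {FVs} v _ _ _ _ _) {w} w∈ = proj₁ (removeV-true FVs v w w∈)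

  vertices⊆ : ∀ {F F'} → Steps F F' → ∀ {w} → FV F' w ≡ true → FV F w ≡ true
  vertices⊆ ε w∈ = w∈
  vertices⊆ (s ◅ ss) w∈ = step-vertices⊆ s (vertices⊆ ss w∈)

  step-keeps : ∀ {F F'} → ContractStep K F F' → ∀ {w} → K w → FV F w ≡ true → FV F' w ≡ true
  step-keeps (delete {FVs} v _ ¬Kv _) Kw = removeV-keeps FVs (λ { refl → ¬Kv Kw })
  step-keeps (shortcut {FVs} v _ _ _ ¬Kv _) Kw = removeV-keeps FVs (λ { refl → ¬Kv Kw })

  keeps : ∀ {F F'} → Steps F F' → ∀ {w} → K w → FV F w ≡ true → FV F' w ≡ true
  keeps ε Kw w∈ = w∈
  keeps (s ◅ ss) Kw w∈ = keeps ss Kw (step-keeps s Kw w∈)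

  step-preserves-uncut : ∀ {F F' S} → ContractStep K F F' → Uncut (FE F) S → Uncut (FE F') S
  step-preserves-uncut (delete {es = es} v _ _ _) uncut e∈ =
    uncut (proj₁ (∈-filterᵇ⁻ _ {xs = es} e∈))
  step-preserves-uncut {S = S} (shortcut {es = es} v x y _ _ nbrs) uncut (here refl) =
    trans (incident-other S x-inc (uncut x∈)) (sym (incident-other S y-inc (uncut y∈)))
    where
    neighbour : ∀ {z} → z ∈ x ∷ y ∷ [] → z ∈ es × incident v z ≡ true
    neighbour z∈ = ∈-filterᵇ⁻ (incident v) (subst (_ ∈_) (sym nbrs) z∈)
    x∈ = proj₁ (neighbour (here refl))
    x-inc = proj₂ (neighbour (here refl))
    y∈ = proj₁ (neighbour (there (here refl)))
    y-inc = proj₂ (neighbour (there (here refl)))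
  step-preserves-uncut (shortcut {es = es} v _ _ _ _ _) uncut (there e∈) =
    uncut (proj₁ (∈-filterᵇ⁻ _ {xs = es} e∈))

  preserves-uncut : ∀ {F F' S} → Steps F F' → Uncut (FE F) S → Uncut (FE F') S
  preserves-uncut ε uncut = uncut
  preserves-uncut (s ◅ ss) uncut = preserves-uncut ss (step-preserves-uncut s uncut)

  Lift : Forest n → Forest n → (Fin n → Bool) → Set
  Lift F F' S = Σ (Fin n → Bool) λ S₀ → Uncut (FE F) S₀ × (∀ {w} → FV F' w ≡ true → S₀ w ≡ S w)

  step-lifts-uncut : ∀ {F F' S} → ContractStep K F F' → Uncut (FE F') S → Lift F F' S
  step-lifts-uncut {S = S} (delete {FVs} {es} v _ _ deg≤1) uncut with filterᵇ (incident v) es in nbrs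
  ... | [] = S [ v ≔ S v ] , override-uncut nbrs (λ ()) uncut , override-removed S FVs
  ... | x ∷ [] =
    S [ v ≔ S (other v x) ] , override-uncut nbrs (λ { (here refl) → refl }) uncut , override-removed S FVs
  step-lifts-uncut (delete v _ _ (s≤s ())) uncut | x ∷ y ∷ _
  step-lifts-uncut {S = S} (shortcut {FVs} {es} v x y _ _ nbrs) uncut =
    S [ v ≔ S (other v x) ] ,
    override-uncut nbrs (λ { (here refl) → refl ; (there (here refl)) → sym (uncut (here refl)) })
                        (λ e∈ → uncut (there e∈)) ,
    override-removed S FVs

  lifts-uncut : ∀ {F F' S} → Steps F F' → Uncut (FE F') S → Lift F F' S
  lifts-uncut {S = S} ε uncut = S , uncut , λ _ → refl
  lifts-uncut (s ◅ ss) uncut with S₁ , uncut₁ , agree₁ ← lifts-uncut ss uncut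
                             with S₀ , uncut₀ , agree₀ ← step-lifts-uncut s uncut₁
    = S₀ , uncut₀ , λ w∈ → trans (agree₀ (vertices⊆ ss w∈)) (agree₁ w∈)

module Clusters {n} (G : Graph n) (ℓ : Partition n) where

  inCluster : Fin n → EdgeSet n
  inCluster p e = Part G ℓ p (src e) ∧ Part G ℓ p (tgt e)

  cluster : Fin n → Graph n
  cluster p = Induced G (Part G ℓ p)

  ∑ : (Fin n → ℕ) → ℕ
  ∑ f = sum (map f (allFin n))

  ∑-cong : ∀ {f g : Fin n → ℕ} → (∀ p → f p ≡ g p) → ∑ f ≡ ∑ g
  ∑-cong f≗g = cong sum (map-cong f≗g (allFin n))

  glue : (Fin n → Fin n → Bool) → Fin n → Bool
  glue R v = R (ℓ v) v

  glue-at : ∀ R {p v} → ℓ v ≡ p → glue R v ≡ R p v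
  glue-at R refl = refl

  Part⇒ : ∀ {p v} → Part G ℓ p v ≡ true → V G v ≡ true × ℓ v ≡ p
  Part⇒ v∈p = ∧-conicalˡ _ _ v∈p , ==⇒≡ (∧-conicalʳ _ _ v∈p)

  Part⇐ : ∀ {p v} → V G v ≡ true → ℓ v ≡ p → Part G ℓ p v ≡ true
  Part⇐ {v = v} v∈V refl = cong₂ _∧_ v∈V (≡⇒== {a = ℓ v} refl)

  inCluster⇒ : ∀ {p e} → inCluster p e ≡ true → EndpointsIn (Part G ℓ p) e
  inCluster⇒ {p} {e} both =
    ∧-conicalˡ (Part G ℓ p (src e)) _ both , ∧-conicalʳ (Part G ℓ p (src e)) _ both

  ∈-cluster⁻ : ∀ {p e} → e ∈ E (cluster p) → e ∈ E G × EndpointsIn (Part G ℓ p) e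
  ∈-cluster⁻ {p} {e} e∈ with e∈G , both ← ∈-filterᵇ⁻ (inCluster p) e∈ =
    e∈G , inCluster⇒ {p} {e} both

  ∈-cluster⁺ : ∀ {p e} → e ∈ E G → EndpointsIn (Part G ℓ p) e → e ∈ E (cluster p)
  ∈-cluster⁺ {p} e∈ (ps , pt) = ∈-filterᵇ⁺ (inCluster p) e∈ (cong₂ _∧_ ps pt)

  cluster-endpoints : ∀ {p e} → e ∈ E (cluster p) → EndpointsIn (V (cluster p)) e
  cluster-endpoints e∈ with _ , ps , pt ← ∈-cluster⁻ e∈ =
    cong₂ _∧_ (proj₁ (Part⇒ ps)) ps , cong₂ _∧_ (proj₁ (Part⇒ pt)) pt

  nonInter⇒sameCluster : ∀ {e} → isInter ℓ e ≡ false → ℓ (src e) ≡ ℓ (tgt e)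
  nonInter⇒sameCluster {e} nonInter = ==⇒≡ (trans (sym (not-involutive _)) (cong not nonInter))

  nonInter-in-clusters : ∀ {e} → EndpointsIn (V G) e → isInter ℓ e ≡ false →
    EndpointsIn (Part G ℓ (ℓ (src e))) e × EndpointsIn (Part G ℓ (ℓ (tgt e))) e
  nonInter-in-clusters {e} (vs , vt) nonInter =
    (Part⇐ vs refl , Part⇐ vt (sym same)) , (Part⇐ vs same , Part⇐ vt refl)
    where same = nonInter⇒sameCluster {e} nonInter

  cluster-cutSize≤ : ∀ p S → cutSize (cluster p) S ≤ cutSize G S
  cluster-cutSize≤ p S = begin
    weightOf (crosses S) (filterᵇ (inCluster p) (E G))
      ≡⟨ cong weight (filterᵇ-filterᵇ (inCluster p) (crosses S) (E G)) ⟩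
    weightOf (λ e → inCluster p e ∧ crosses S e) (E G)
      ≤⟨ weightOf-mono (E G) (λ _ → ∧-conicalʳ _ _) ⟩
    weightOf (crosses S) (E G) ∎
    where open ≤-Reasoning

  edge-counted-once : ∀ {e} → EndpointsIn (V G) e → ∀ r →
    r ≡ r when isInter ℓ e + ∑ (λ p → r when inCluster p e)
  edge-counted-once {e} (vs , vt) r = by-cases (ℓ (src e) ≟ ℓ (tgt e))
    where
    open ≡-Reasoning
    Σclusters = ∑ (λ p → r when inCluster p e)

    by-cases : Dec (ℓ (src e) ≡ ℓ (tgt e)) → r ≡ r when isInter ℓ e + Σclusters
    by-cases (yes same) = begin
      r                                  ≡⟨ sum-allFin-δ (ℓ (src e)) r ⟨
      ∑ (λ p → r when (ℓ (src e) == p))  ≡⟨ ∑-cong (λ p → cong (r when_) (sym (inside p))) ⟩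
      Σclusters                          ≡⟨ cong (λ b → r when not b + Σclusters) (≡⇒== same) ⟨
      r when isInter ℓ e + Σclusters     ∎
      where
      inside : ∀ p → inCluster p e ≡ (ℓ (src e) == p)
      inside p = trans (cong₂ _∧_ (cong (_∧ _) vs) (trans (cong (_∧ _) vt) (cong (_== p) (sym same))))
                       (∧-idem (ℓ (src e) == p))
    by-cases (no differ) = begin
      r                               ≡⟨ +-identityʳ r ⟨
      r + 0                           ≡⟨ cong₂ _+_ (cong (λ b → r when not b) (≢⇒== differ))
                                                   (sum-map-zero _ (allFin n) (cong (r when_) ∘ outside)) ⟨
      r when isInter ℓ e + Σclusters  ∎
      where
      outside : ∀ p → inCluster p e ≡ false
      outside p with inCluster p e in both
      ... | false = refl
      ... | true  with ps , pt ← inCluster⇒ {p} {e} both =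
        ⊥-elim (differ (trans (proj₂ (Part⇒ ps)) (sym (proj₂ (Part⇒ pt)))))

  cluster-decomposition : ∀ Q {es} → All (EndpointsIn (V G)) es →
    weightOf Q es ≡ weightOf Q (filterᵇ (isInter ℓ) es)
                  + ∑ (λ p → weightOf Q (filterᵇ (inCluster p) es))
  cluster-decomposition Q [] = sym (sum-map-zero _ (allFin n) (λ _ → refl))
  cluster-decomposition Q {e ∷ es} (e-ends ∷ es-ends) = begin
    weightOf Q (e ∷ es)
      ≡⟨ weightOf-∷ Q e es ⟩
    r + weightOf Q es
      ≡⟨ cong₂ _+_ (edge-counted-once {e} e-ends r) (cluster-decomposition Q es-ends) ⟩
    (r when isInter ℓ e + ∑ rₚ) + (W (isInter ℓ) + ∑ Wₚ)
      ≡⟨ interchange (r when isInter ℓ e) (∑ rₚ) (W (isInter ℓ)) (∑ Wₚ) ⟩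
    (r when isInter ℓ e + W (isInter ℓ)) + (∑ rₚ + ∑ Wₚ)
      ≡⟨ cong (r when isInter ℓ e + W (isInter ℓ) +_) (sum-map-+ rₚ Wₚ (allFin n)) ⟨
    (r when isInter ℓ e + W (isInter ℓ)) + ∑ (λ p → rₚ p + Wₚ p)
      ≡⟨ cong₂ _+_ (weightOf-filterᵇ-∷ Q (isInter ℓ) e es)
                   (∑-cong (λ p → weightOf-filterᵇ-∷ Q (inCluster p) e es)) ⟨
    weightOf Q (filterᵇ (isInter ℓ) (e ∷ es))
      + ∑ (λ p → weightOf Q (filterᵇ (inCluster p) (e ∷ es))) ∎
    where
    open ≡-Reasoning
    r = mult e when Q e
    W : EdgeSet n → ℕ
    W P = weightOf Q (filterᵇ P es)
    rₚ Wₚ : Fin n → ℕ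
    rₚ p = r when inCluster p e
    Wₚ p = W (inCluster p)

module Sparsified {n} (G : Graph n) (ℓ : Partition n) (CC : EdgeSet n) (F : Forest n)
  (endpoints : ∀ {e} → e ∈ E G → EndpointsIn (V G) e)
  (inter⊆CC : ∀ {e} → e ∈ E G → isInter ℓ e ≡ true → CC e ≡ true)
  (spanning : IsSpanningForest (G ∖ₑ CC) F)
  (γ : ℕ) (cf : Fin n → Forest n)
  (contraction : ∀ p → IsContraction (KeepSet G ℓ CC p) (InducedForest F (Part G ℓ p)) (cf p)) where

  open Clusters G ℓ

  H : Graph n
  H = Sparsifier γ G ℓ CC cf

  heavy : Fin n × Fin n → Edge n
  heavy ab = proj₁ ab , proj₂ ab , γ

  interEdges : List (Edge n)
  interEdges = filterᵇ (isInter ℓ) (E G)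

  CCEdges contractedEdges sparseCluster : Fin n → List (Edge n)
  CCEdges p = filterᵇ CC (E (cluster p))
  contractedEdges p = map heavy (FE (cf p))
  sparseCluster p = CCEdges p ++ contractedEdges p

  F[_] : Fin n → Forest n
  F[ p ] = InducedForest F (Part G ℓ p)

  steps : ∀ p → Contraction.Steps (KeepSet G ℓ CC p) F[ p ] (cf p)
  steps p = proj₁ (contraction p)

  ∈-H⁻ : ∀ {e} → e ∈ E H →
    (e ∈ E G × CC e ≡ true) ⊎ (∃ λ p → ∃ λ ab → ab ∈ FE (cf p) × e ≡ heavy ab)
  ∈-H⁻ e∈ with ∈-++⁻ interEdges e∈
  ... | inj₁ e∈inter with e∈G , inter ← ∈-filterᵇ⁻ (isInter ℓ) e∈inter =
    inj₁ (e∈G , inter⊆CC e∈G inter)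
  ... | inj₂ e∈clusters with p , _ , e∈p ← find (∈-concatMap⁻ sparseCluster {xs = allFin n} e∈clusters)
                        with ∈-++⁻ (CCEdges p) e∈p
  ...   | inj₁ e∈CC with e∈cl , cc ← ∈-filterᵇ⁻ CC e∈CC = inj₁ (proj₁ (∈-cluster⁻ e∈cl) , cc)
  ...   | inj₂ e∈heavy with ab , ab∈ , refl ← ∈-map⁻ heavy e∈heavy = inj₂ (p , ab , ab∈ , refl)

  ∈-H-sparseCluster : ∀ {p e} → e ∈ sparseCluster p → e ∈ E H
  ∈-H-sparseCluster {p} e∈ = ∈-++⁺ʳ interEdges (∈-concatMap⁺ sparseCluster (lose (∈-allFin p) e∈))

  ∈-H-heavy : ∀ {p ab} → ab ∈ FE (cf p) → heavy ab ∈ E H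
  ∈-H-heavy {p} ab∈ = ∈-H-sparseCluster (∈-++⁺ʳ (CCEdges p) (∈-map⁺ heavy ab∈))

  CC-in-H : ∀ {e} → e ∈ E G → CC e ≡ true → e ∈ E H
  CC-in-H {e} e∈ cc with isInter ℓ e in inter
  ... | true  = ∈-++⁺ˡ (∈-filterᵇ⁺ (isInter ℓ) e∈ inter)
  ... | false with in-src , _ ← nonInter-in-clusters {e} (endpoints e∈) inter =
    ∈-H-sparseCluster (∈-++⁺ˡ (∈-filterᵇ⁺ CC (∈-cluster⁺ e∈ in-src) cc))

  V-H⁺ : ∀ {p v} → FV (cf p) v ≡ true → V H v ≡ true
  V-H⁺ {p} {v} v∈ =
    Equivalence.to T-≡ (any⁺ (λ q → FV (cf q) v) (lose (∈-allFin p) (Equivalence.from T-≡ v∈)))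

  V-H⁻ : ∀ {v} → V H v ≡ true → ∃ λ p → FV (cf p) v ≡ true
  V-H⁻ {v} v∈ with p , _ , v∈p ← find (any⁻ (λ q → FV (cf q) v) (allFin n) (Equivalence.from T-≡ v∈)) =
    p , Equivalence.to T-≡ v∈p

  Survives : Fin n → Set
  Survives v = FV (cf (ℓ v)) v ≡ true

  kept-survives : ∀ {v} → KeepSet G ℓ CC (ℓ v) v → V G v ≡ true → Survives v
  kept-survives {v} kept v∈ = Contraction.keeps (KeepSet G ℓ CC (ℓ v)) (steps (ℓ v)) kept
    (cong₂ _∧_ (trans (proj₁ spanning v) v∈) (Part⇐ v∈ refl))

  terminal-V : ∀ {t} → Terminal G ℓ t → V G t ≡ true
  terminal-V (e , e∈ , _ , inj₁ refl) = proj₁ (endpoints e∈)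
  terminal-V (e , e∈ , _ , inj₂ refl) = proj₂ (endpoints e∈)

  terminal-survives : ∀ {t} → Terminal G ℓ t → Survives t
  terminal-survives t-term = kept-survives (inj₁ (t-term , Part⇐ (terminal-V t-term) refl)) (terminal-V t-term)

  CC-endpoints-survive : ∀ {e} → e ∈ E G → CC e ≡ true → Survives (src e) × Survives (tgt e)
  CC-endpoints-survive {e} e∈ cc with isInter ℓ e in inter
  ... | true  =
    terminal-survives (e , e∈ , inter , inj₁ refl) , terminal-survives (e , e∈ , inter , inj₂ refl)
  ... | false with in-src , in-tgt ← nonInter-in-clusters {e} (endpoints e∈) inter =
    kept-survives (inj₂ (e , ∈-cluster⁺ e∈ in-src , cc , inj₁ refl)) (proj₁ (endpoints e∈)) ,
    kept-survives (inj₂ (e , ∈-cluster⁺ e∈ in-tgt , cc , inj₂ refl)) (proj₂ (endpoints e∈))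

  H-vertex : ∀ {v} → V H v ≡ true → V G v ≡ true × Survives v
  H-vertex {v} v∈H with p , v∈cf ← V-H⁻ v∈H
    with v∈F[p] ← Contraction.vertices⊆ (KeepSet G ℓ CC p) (steps p) v∈cf
    with v∈V , ℓv≡p ← Part⇒ (∧-conicalʳ (FV F v) _ v∈F[p])
    = v∈V , subst (λ q → FV (cf q) v ≡ true) (sym ℓv≡p) v∈cf

  nonCC-edge : ∀ {e} → e ∈ E (G ∖ₑ CC) → e ∈ E G × CC e ≡ false
  nonCC-edge {e} e∈ with e∈G , ¬cc ← ∈-filterᵇ⁻ (λ e → not (CC e)) e∈ =
    e∈G , trans (sym (not-involutive (CC e))) (cong not ¬cc)

  forest-edge-underlying : ∀ {a b} → (a , b) ∈ FE F →
    Σ (Edge n) λ e → e ∈ E G × CC e ≡ false × SamePair (ends e) (a , b)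
  forest-edge-underlying ab∈ with proj₂ (proj₁ (proj₂ spanning) _ _ ab∈)
  ... | α , inj₁ e∈ with e∈G , ¬cc ← nonCC-edge e∈ = _ , e∈G , ¬cc , inj₁ (refl , refl)
  ... | α , inj₂ e∈ with e∈G , ¬cc ← nonCC-edge e∈ = _ , e∈G , ¬cc , inj₂ (refl , refl)

  nonCC-in-cluster : ∀ {e} → e ∈ E G → CC e ≡ false → EndpointsIn (Part G ℓ (ℓ (src e))) e
  nonCC-in-cluster {e} e∈ ¬cc with isInter ℓ e in inter
  ... | true  = ⊥-elim (true≢false (trans (sym (inter⊆CC e∈ inter)) ¬cc))
  ... | false = proj₁ (nonInter-in-clusters {e} (endpoints e∈) inter)

  forest-edge-in-cluster : ∀ {a b} → (a , b) ∈ FE F →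
    ∃ λ p → (a , b) ∈ FE F[ p ] × ℓ a ≡ p × ℓ b ≡ p
  forest-edge-in-cluster ab∈ with e , e∈ , ¬cc , same ← forest-edge-underlying ab∈
    with pa , pb ← samePair⇒ {X = Part G ℓ (ℓ (src e))} {e} same (nonCC-in-cluster e∈ ¬cc)
    = ℓ (src e) , ∈-filterᵇ⁺ _ ab∈ (cong₂ _∧_ pa pb) , proj₂ (Part⇒ pa) , proj₂ (Part⇒ pb)

  F[]-edge⇒ : ∀ {p a b} → (a , b) ∈ FE F[ p ] →
    (a , b) ∈ FE F × Part G ℓ p a ≡ true × Part G ℓ p b ≡ true
  F[]-edge⇒ {p} {a} ab∈p
    with ab∈ , both ← ∈-filterᵇ⁻ (λ (a , b) → Part G ℓ p a ∧ Part G ℓ p b) {xs = FE F} ab∈p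
    = ab∈ , ∧-conicalˡ (Part G ℓ p a) _ both , ∧-conicalʳ (Part G ℓ p a) _ both

  cluster-forest-edge : ∀ {p a b} → (a , b) ∈ FE F[ p ] →
    Σ (Edge n) λ e → e ∈ E (cluster p) × CC e ≡ false × SamePair (ends e) (a , b)
  cluster-forest-edge {p} ab∈p with ab∈ , pa , pb ← F[]-edge⇒ ab∈p
                              with e , e∈ , ¬cc , same ← forest-edge-underlying ab∈ =
    e , ∈-cluster⁺ e∈ (samePair⇐ {X = Part G ℓ p} {e} same pa pb) , ¬cc , same

  contracted-weight-zero : ∀ p {S} → Uncut (FE (cf p)) S → weightOf (crosses S) (contractedEdges p) ≡ 0
  contracted-weight-zero p {S} uncut = weightOf-none (crosses S) _ uncrossed
    where
    uncrossed : ∀ {e} → e ∈ contractedEdges p → crosses S e ≡ false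
    uncrossed e∈ with (a , b) , ab∈ , refl ← ∈-map⁻ heavy {xs = FE (cf p)} e∈ =
      ≡⇒xor-false (uncut ab∈)

  inter-weight-cong : ∀ {S S'} → (∀ {t} → Terminal G ℓ t → S' t ≡ S t) →
    weightOf (crosses S') interEdges ≡ weightOf (crosses S) interEdges
  inter-weight-cong {S} {S'} S'≗S = cong weight (filterᵇ-cong _ same-crossing)
    where
    same-crossing : ∀ {e} → e ∈ interEdges → crosses S' e ≡ crosses S e
    same-crossing {e} e∈ with e∈G , inter ← ∈-filterᵇ⁻ (isInter ℓ) e∈ =
      crosses-cong {S = S'} {S} e (S'≗S (e , e∈G , inter , inj₁ refl)) (S'≗S (e , e∈G , inter , inj₂ refl))

  weight-H : ∀ Q → weightOf Q (E H) ≡ weightOf Q interEdges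
                                   + ∑ (λ p → weightOf Q (CCEdges p) + weightOf Q (contractedEdges p))
  weight-H Q = trans (weightOf-++ Q interEdges _) (cong (weightOf Q interEdges +_)
    (trans (weightOf-concatMap Q sparseCluster (allFin n)) (∑-cong (λ p → weightOf-++ Q (CCEdges p) _))))

  weight-G : ∀ Q → weightOf Q (E G) ≡ weightOf Q interEdges + ∑ (λ p → weightOf Q (E (cluster p)))
  weight-G Q = cluster-decomposition Q (All.tabulate endpoints)

  module CutOfH {c} (c<γ : c < γ) {S} (S-cut : IsCCut c H S) where

    contracted-uncut : ∀ p → Uncut (FE (cf p)) S
    contracted-uncut p {a} {b} ab∈ with crosses S (heavy (a , b)) in crossing
    ... | false = xor-false⇒≡ crossing
    ... | true  =
      ⊥-elim (<⇒≱ c<γ (≤-trans (mult≤weightOf (crosses S) (∈-H-heavy ab∈) crossing) (proj₂ S-cut)))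

    lift : ∀ p → Contraction.Lift (KeepSet G ℓ CC p) F[ p ] (cf p) S
    lift p = Contraction.lifts-uncut (KeepSet G ℓ CC p) (steps p) (contracted-uncut p)

    lifted : Fin n → Fin n → Bool
    lifted p = proj₁ (lift p)

    S' : Fin n → Bool
    S' = glue lifted

    S'-survivor : ∀ {v} → Survives v → S' v ≡ S v
    S'-survivor {v} v∈ = proj₂ (proj₂ (lift (ℓ v))) v∈

    S'-uncut : Uncut (FE F) S'
    S'-uncut ab∈ with p , ab∈p , ℓa≡p , ℓb≡p ← forest-edge-in-cluster ab∈ =
      trans (glue-at lifted ℓa≡p) (trans (proj₁ (proj₂ (lift p)) ab∈p) (sym (glue-at lifted ℓb≡p)))

    nonCC-uncrossed : ∀ {e} → e ∈ E G → CC e ≡ false → crosses S' e ≡ false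
    nonCC-uncrossed {e} e∈ ¬cc =
      ≡⇒xor-false (uncut-connected S'-uncut (connects e (∈-filterᵇ⁺ _ e∈ (cong not ¬cc))))
      where connects = proj₂ (proj₂ (proj₂ (proj₂ spanning)))

    CC-crosses : ∀ {e} → e ∈ E G → CC e ≡ true → crosses S' e ≡ crosses S e
    CC-crosses {e} e∈ cc with s , t ← CC-endpoints-survive e∈ cc =
      crosses-cong {S = S'} {S} e (S'-survivor s) (S'-survivor t)

    crosses-S' : ∀ {e} → e ∈ E G → crosses S' e ≡ (CC e ∧ crosses S e)
    crosses-S' {e} e∈ with CC e in cc
    ... | true  = CC-crosses e∈ cc
    ... | false = nonCC-uncrossed e∈ cc

    S'-cut : IsCut G S'
    S'-cut with (v , v∈ , Sv) , (w , w∈ , Sw) ← proj₁ S-cut =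
      (v , proj₁ (H-vertex v∈) , trans (S'-survivor (proj₂ (H-vertex v∈))) Sv) ,
      (w , proj₁ (H-vertex w∈) , trans (S'-survivor (proj₂ (H-vertex w∈))) Sw)

    same-cutSet : ∀ e → (e ∈ cutSet H S → e ∈ cutSet G S') × (e ∈ cutSet G S' → e ∈ cutSet H S)
    same-cutSet e = to , from
      where
      to : e ∈ cutSet H S → e ∈ cutSet G S'
      to e∈cut with e∈H , crossing ← ∈-filterᵇ⁻ (crosses S) e∈cut with ∈-H⁻ e∈H
      ... | inj₁ (e∈G , cc) = ∈-filterᵇ⁺ (crosses S') e∈G (trans (CC-crosses e∈G cc) crossing)
      ... | inj₂ (p , (a , b) , ab∈ , refl) =
        ⊥-elim (true≢false (trans (sym crossing) (≡⇒xor-false (contracted-uncut p ab∈))))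
      from : e ∈ cutSet G S' → e ∈ cutSet H S
      from e∈cut with e∈G , crossing ← ∈-filterᵇ⁻ (crosses S') e∈cut with CC e in cc
      ... | true  = ∈-filterᵇ⁺ (crosses S) (CC-in-H e∈G cc) (trans (sym (CC-crosses e∈G cc)) crossing)
      ... | false = ⊥-elim (true≢false (trans (sym crossing) (nonCC-uncrossed e∈G cc)))

    same-size : cutSize G S' ≡ cutSize H S
    same-size = begin
      cutSize G S'
        ≡⟨ weight-G (crosses S') ⟩
      weightOf (crosses S') interEdges + ∑ (λ p → weightOf (crosses S') (E (cluster p)))
        ≡⟨ cong₂ _+_ (inter-weight-cong (S'-survivor ∘ terminal-survives)) (∑-cong cluster-part) ⟩
      weightOf (crosses S) interEdges
        + ∑ (λ p → weightOf (crosses S) (CCEdges p) + weightOf (crosses S) (contractedEdges p))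
        ≡⟨ weight-H (crosses S) ⟨
      cutSize H S ∎
      where
      open ≡-Reasoning
      cluster-part : ∀ p → weightOf (crosses S') (E (cluster p))
                         ≡ weightOf (crosses S) (CCEdges p) + weightOf (crosses S) (contractedEdges p)
      cluster-part p = begin
        weightOf (crosses S') (E (cluster p))
          ≡⟨ cong weight (filterᵇ-cong _ (crosses-S' ∘ proj₁ ∘ ∈-cluster⁻)) ⟩
        weightOf (λ e → CC e ∧ crosses S e) (E (cluster p))
          ≡⟨ cong weight (filterᵇ-filterᵇ CC (crosses S) (E (cluster p))) ⟨
        weightOf (crosses S) (CCEdges p)
          ≡⟨ +-identityʳ _ ⟨
        weightOf (crosses S) (CCEdges p) + 0
          ≡⟨ cong (weightOf (crosses S) (CCEdges p) +_) (contracted-weight-zero p (contracted-uncut p)) ⟨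
        weightOf (crosses S) (CCEdges p) + weightOf (crosses S) (contractedEdges p) ∎

  module CutOfG {c} (Xs : Fin n → EdgeSet n)
    (Xs-containment : ∀ p → IsContainmentSet c (cluster p) (TerminalIn G ℓ p) (Xs p))
    (Xs⊆CC : ∀ p {e} → e ∈ E (cluster p) → Xs p e ≡ true → CC e ≡ true)
    {S} (S-small : cutSize G S ≤ c) where

    replacement : ∀ p → ContainedReplacement (cluster p) (TerminalIn G ℓ p) (Xs p) S
    replacement p with cutSet (cluster p) S in crossing
    ... | [] = uncut-replacement crossing
    ... | e ∷ _ =
      contained-replacement (Xs-containment p) (S-cuts-cluster , ≤-trans (cluster-cutSize≤ p S) S-small)
      where
      e∈cut : e ∈ cutSet (cluster p) S
      e∈cut = subst (e ∈_) (sym crossing) (here refl)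
      S-cuts-cluster : IsCut (cluster p) S
      S-cuts-cluster =
        crossing⇒IsCut (cluster p) S e∈cut (cluster-endpoints (proj₁ (∈-filterᵇ⁻ (crosses S) e∈cut)))

    R : Fin n → Fin n → Bool
    R p = ContainedReplacement.cut (replacement p)

    S' : Fin n → Bool
    S' = glue R

    S'-terminal : ∀ {t} → Terminal G ℓ t → S' t ≡ S t
    S'-terminal {t} t-term =
      ContainedReplacement.agrees (replacement (ℓ t)) t (t-term , Part⇐ (terminal-V t-term) refl)

    S'-on-cluster : ∀ {p v} → Part G ℓ p v ≡ true → S' v ≡ R p v
    S'-on-cluster v∈p = glue-at R (proj₂ (Part⇒ v∈p))

    R-uncut : ∀ p → Uncut (FE F[ p ]) (R p)
    R-uncut p ab∈ with e , e∈ , ¬cc , same ← cluster-forest-edge ab∈ =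
      xor-false⇒≡ (trans (sym (crosses-samePair (R p) e same)) uncrossed)
      where
      uncrossed : crosses (R p) e ≡ false
      uncrossed with crosses (R p) e in crossing
      ... | false = refl
      ... | true  = ⊥-elim (true≢false (trans (sym (Xs⊆CC p e∈ in-Xs)) ¬cc))
        where in-Xs = ContainedReplacement.contained (replacement p) (∈-filterᵇ⁺ (crosses (R p)) e∈ crossing)

    S'-contracted-uncut : ∀ p → Uncut (FE (cf p)) S'
    S'-contracted-uncut p = Contraction.preserves-uncut (KeepSet G ℓ CC p) (steps p) uncut
      where
      uncut : Uncut (FE F[ p ]) S'
      uncut ab∈ with _ , pa , pb ← F[]-edge⇒ ab∈ =
        trans (S'-on-cluster pa) (trans (R-uncut p ab∈) (sym (S'-on-cluster pb)))

    S'-cut : (∃ λ t → Terminal G ℓ t × S t ≡ true) → (∃ λ t → Terminal G ℓ t × S t ≡ false) →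
      IsCut H S'
    S'-cut (t , t-term , St) (u , u-term , Su) =
      (t , V-H⁺ (terminal-survives t-term) , trans (S'-terminal t-term) St) ,
      (u , V-H⁺ (terminal-survives u-term) , trans (S'-terminal u-term) Su)

    no-larger : cutSize H S' ≤ cutSize G S
    no-larger = begin
      cutSize H S'
        ≡⟨ weight-H (crosses S') ⟩
      weightOf (crosses S') interEdges
        + ∑ (λ p → weightOf (crosses S') (CCEdges p) + weightOf (crosses S') (contractedEdges p))
        ≤⟨ +-mono-≤ (≤-reflexive (inter-weight-cong S'-terminal))
                    (sum-map-mono _ _ (allFin n) cluster-part) ⟩
      weightOf (crosses S) interEdges + ∑ (λ p → weightOf (crosses S) (E (cluster p)))
        ≡⟨ weight-G (crosses S) ⟨
      cutSize G S ∎
      where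
      open ≤-Reasoning
      cluster-part : ∀ p → weightOf (crosses S') (CCEdges p) + weightOf (crosses S') (contractedEdges p)
                         ≤ weightOf (crosses S) (E (cluster p))
      cluster-part p = begin
        weightOf (crosses S') (CCEdges p) + weightOf (crosses S') (contractedEdges p)
          ≡⟨ cong (weightOf (crosses S') (CCEdges p) +_) (contracted-weight-zero p (S'-contracted-uncut p)) ⟩
        weightOf (crosses S') (CCEdges p) + 0
          ≡⟨ +-identityʳ _ ⟩
        weightOf (crosses S') (CCEdges p)
          ≡⟨ cong weight (filterᵇ-filterᵇ CC (crosses S') (E (cluster p))) ⟩
        weightOf (λ e → CC e ∧ crosses S' e) (E (cluster p))
          ≤⟨ weightOf-mono (E (cluster p)) S'-crossing⇒R-crossing ⟩
        weightOf (crosses (R p)) (E (cluster p))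
          ≤⟨ ContainedReplacement.no-larger (replacement p) ⟩
        weightOf (crosses S) (E (cluster p)) ∎
        where
        S'-crossing⇒R-crossing : ∀ {e} → e ∈ E (cluster p) → (CC e ∧ crosses S' e) ≡ true →
          crosses (R p) e ≡ true
        S'-crossing⇒R-crossing {e} e∈ both with _ , ps , pt ← ∈-cluster⁻ e∈ =
          trans (crosses-cong {S = R p} {S'} e (sym (S'-on-cluster ps)) (sym (S'-on-cluster pt)))
                (∧-conicalʳ _ _ both)

lemma4p2 : ∀ {n} (G : Graph n) (ℓ : Partition n) (c : ℕ) (CC : EdgeSet n) (F : Forest n)
    → IsMultigraph G
    → 1 ≤ c
    → ContainmentSetFor c G ℓ CC
    → IsSpanningForest (G ∖ₑ CC) F
    → (γ : ℕ) → c < γ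
    → (cf : Fin n → Forest n)
    → (∀ p → IsContraction (KeepSet G ℓ CC p) (InducedForest F (Part G ℓ p)) (cf p))
    → let H = Sparsifier γ G ℓ CC cf in
      (∀ S → IsCCut c H S →
         ∃ λ S' → IsCut G S'
           × (∀ e → (e ∈ cutSet H S → e ∈ cutSet G S') × (e ∈ cutSet G S' → e ∈ cutSet H S))
           × cutSize G S' ≡ cutSize H S)
      × (∀ S → IsCCut c G S
           → (∃ λ t → Terminal G ℓ t × S t ≡ true)
           → (∃ λ t → Terminal G ℓ t × S t ≡ false)
           → ∃ λ S' → IsCut H S' × cutSize H S' ≤ cutSize G S × Separates (Terminal G ℓ) S S')
lemma4p2 G ℓ c CC F multigraph _ (Xs , Xs-containment , CC-covers) spanning γ c<γ cf contraction =
  (λ S S-cut → let open CutOfH c<γ S-cut in S' , S'-cut , same-cutSet , same-size) ,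
  (λ S S-cut t u → let open CutOfG Xs Xs-containment Xs⊆CC {S} (proj₂ S-cut) in
    S' , S'-cut t u , no-larger , inj₁ (λ _ → S'-terminal))
  where
  endpoints : ∀ {e} → e ∈ E G → EndpointsIn (V G) e
  endpoints e∈ with vs , vt , _ ← proj₁ multigraph _ e∈ = vs , vt

  inter⊆CC : ∀ {e} → e ∈ E G → isInter ℓ e ≡ true → CC e ≡ true
  inter⊆CC e∈ inter = proj₂ (CC-covers _ e∈) (inj₁ inter)

  open Clusters G ℓ using (cluster; ∈-cluster⁻)
  open Sparsified G ℓ CC F endpoints inter⊆CC spanning γ cf contraction

  Xs⊆CC : ∀ p {e} → e ∈ E (cluster p) → Xs p e ≡ true → CC e ≡ true
  Xs⊆CC p e∈ inXs = proj₂ (CC-covers _ (proj₁ (∈-cluster⁻ e∈))) (inj₂ (p , e∈ , inXs))
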